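{- Let $\lambda$ be a gap-free partition with smallest part $s(\lambda)>1$, and let $r\in\{\bar{\ell}(\lambda)-1,\bar{\ell}(\lambda)\}$. Then: (1) $\bar{\ell}(\xi_r(\lambda))\in\{r,r+1\}$; (2) $\bar{\ell}(\xi^-_r(\lambda))\in\{r,r+1\}$; (3) $\xi^-_r$ is inverse to $\xi_r$, i.e. $\xi^-_r(\xi_r(\lambda))=\lambda$ and $\xi_r(\xi^-_r(\lambda))=\lambda$.
   Context: A partition is a finite multiset of positive integers; $\bar{\ell}(\lambda)$ is its number of distinct part values and $s(\lambda)$ its smallest part. A partition is gap-free if its distinct part values form a set of consecutive integers (equivalently, consecutive parts in nonincreasing order differ by at most $1$). For a gap-free partition $\lambda$ and $0\leq r\leq\bar{\ell}(\lambda)$: the increasing operator $\xi_r$ produces $\xi_r(\lambda)$ by taking the $r$ smallest distinct part values $v$ of $\lambda$ and, for each of them simultaneously, replacing one copy of $v$ by $v+1$ (so the weight increases by $r$); the decreasing operator $\xi^-_r$ produces $\xi^-_r(\lambda)$ by taking the $r$ largest distinct part values $v$ of $\lambda$ and, for each simultaneously, replacing one copy of $v$ by $v-1$ (so the weight decreases by $r$). -}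

module Defs where

open import Data.Nat using (ℕ; zero; suc; pred; _≤_; _<_)
open import Data.Nat.Properties using (_≟_)
open import Data.List using (List; []; _∷_; length; reverse; deduplicate)
open import Data.List.Relation.Unary.All using (All)
open import Data.List.Relation.Unary.Linked using (Linked)
open import Data.Product using (_×_)
open import Relation.Nullary using (yes; no)

-- CONVENTION: a partition (finite multiset of positive integers) is
-- represented canonically by the list of its parts in NONDECREASING order.
-- Two partitions are equal iff these lists are equal.
IsPartition : List ℕ → Set
IsPartition xs = Linked _≤_ xs × All (1 ≤_) xs

ℓ̄ : List ℕ → ℕ
ℓ̄ xs = length (deduplicate _≟_ xs)

GapFree : List ℕ → Set
GapFree xs = Linked (λ a b → b ≤ suc a) xs

SmallestPartGt1 : List ℕ → Set
SmallestPartGt1 [] = Data.Empty.⊥ where import Data.Empty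
SmallestPartGt1 (x ∷ xs) = 1 < x

-- bump f r xs: walk through the distinct values of xs in list order and,
-- for each of the first r of them, replace the LAST copy of that value
-- (in list order) by f applied to it.
bump : (ℕ → ℕ) → ℕ → List ℕ → List ℕ
bumpFrom : (ℕ → ℕ) → ℕ → ℕ → List ℕ → List ℕ
bumpFrom f r x [] = f x ∷ []
bumpFrom f r x (y ∷ ys) with x ≟ y
... | yes _ = x ∷ bumpFrom f r y ys
... | no _ = f x ∷ bump f r (y ∷ ys)
bump f zero xs = xs
bump f (suc r) [] = []
bump f (suc r) (x ∷ xs) = bumpFrom f r x xs

-- increasing operator ξ_r: on the nondecreasing list, the r smallest distinct
-- values come first; one copy of each (the last one, keeping the list sorted)
-- is replaced by v+1.
ξ : ℕ → List ℕ → List ℕ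
ξ r xs = bump suc r xs

-- decreasing operator ξ⁻_r: reversing gives the nonincreasing list, where the
-- r largest distinct values come first; one copy of each (the last one in
-- nonincreasing order, keeping sortedness) is replaced by v-1.
ξ⁻ : ℕ → List ℕ → List ℕ
ξ⁻ r xs = reverse (bump pred r (reverse xs))

module Submission where

open import Defs
open import Data.Nat using (ℕ; zero; suc; pred; _+_; _≤_)
open import Data.Nat.Properties
  using (_≟_; ≤-refl; ≤-trans; ≤-antisym; n≤1+n; ≤∧≢⇒<; <⇒≢; +-comm; +-identityʳ; suc-injective)
open import Data.List using (List; []; _∷_; _++_; _∷ʳ_; length; reverse; deduplicate)
open import Data.List.Properties
  using (++-assoc; reverse-++; unfold-reverse; reverse-involutive; filter-all; filter-reject; filter-idem)
open import Data.List.Relation.Unary.All as All using (All)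
open import Data.List.Relation.Unary.All.Properties using (deduplicate⁺)
open import Data.List.Relation.Unary.Linked as Linked using (Linked; []; [-]; _∷_)
open import Data.List.Relation.Unary.Linked.Properties using (Linked⇒All)
open import Data.Product using (_×_; _,_; ∃₂)
open import Data.Sum as Sum using (_⊎_; inj₁; inj₂)
open import Function using (_∘_; flip)
open import Relation.Nullary using (yes; no; ¬?; contradiction)
open import Relation.Binary.PropositionalEquality
  using (_≡_; _≢_; refl; sym; trans; cong; cong₂; subst; subst₂; module ≡-Reasoning)

-- Write λ in nondecreasing order as a staircase x₀ ≤ ⋯ ≤ xₘ (consecutive parts equal or
-- differing by 1) and let c be the number of i with xᵢ ≠ xᵢ₊₁, so that ℓ̄ λ = c + 1.  Bumping the
-- last copy of each part value v to v + 1 turns it into the next part, so ξ_{c+b} (b ∈ {0, 1})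
-- drops x₀ and appends xₘ + b; reading λ backwards, ξ⁻_{c+b} drops xₘ and prepends x₀ − b.
-- Hence for every staircase a ∷ ms ∷ʳ z with c′ changes, ξ_{c′} and ξ⁻_{c′} exchange a ∷ ms and
-- ms ∷ʳ z, each of which has c′ or c′ + 1 distinct parts.  The theorem applies this to the two
-- staircases extending λ by one step, at its end and at its start (which needs x₀ ≥ 1).

WithinOne : ℕ → ℕ → Set
WithinOne r n = n ≡ r ⊎ n ≡ suc r

changesFrom : ℕ → List ℕ → ℕ
changesFrom x []       = 0
changesFrom x (y ∷ ys) with x ≟ y
... | yes _ = changesFrom y ys
... | no  _ = suc (changesFrom y ys)

changes : List ℕ → ℕ
changes []       = 0
changes (x ∷ xs) = changesFrom x xs

changesFrom-++ : ∀ x xs y ys →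
                 changesFrom x (xs ++ y ∷ ys) ≡ changesFrom x (xs ∷ʳ y) + changesFrom y ys
changesFrom-++ x [] y ys with x ≟ y
... | yes _ = refl
... | no  _ = refl
changesFrom-++ x (x′ ∷ xs) y ys with x ≟ x′
... | yes _ = changesFrom-++ x′ xs y ys
... | no  _ = cong suc (changesFrom-++ x′ xs y ys)

changes-++ : ∀ xs y ys → changes (xs ++ y ∷ ys) ≡ changes (xs ∷ʳ y) + changes (y ∷ ys)
changes-++ []       y ys = refl
changes-++ (x ∷ xs) y ys = changesFrom-++ x xs y ys

changes-swap : ∀ x y → changes (x ∷ y ∷ []) ≡ changes (y ∷ x ∷ [])
changes-swap x y with x ≟ y | y ≟ x
... | yes _   | yes _   = refl
... | no  _   | no  _   = refl
... | yes x≡y | no  y≢x = contradiction (sym x≡y) y≢x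
... | no  x≢y | yes y≡x = contradiction (sym y≡x) x≢y

changes-reverse : ∀ xs → changes (reverse xs) ≡ changes xs
changes-reverse []           = refl
changes-reverse (x ∷ [])     = refl
changes-reverse (x ∷ y ∷ ys) = begin
  changes (reverse (x ∷ y ∷ ys))                   ≡⟨ cong changes (reverse-++ (x ∷ y ∷ []) ys) ⟩
  changes (reverse ys ++ y ∷ x ∷ [])               ≡⟨ changes-++ (reverse ys) y (x ∷ []) ⟩
  changes (reverse ys ∷ʳ y) + changes (y ∷ x ∷ []) ≡⟨ cong (λ l → changes l + _) (unfold-reverse y ys) ⟨
  changes (reverse (y ∷ ys)) + changes (y ∷ x ∷ []) ≡⟨ cong₂ _+_ (changes-reverse (y ∷ ys)) (changes-swap y x) ⟩
  changes (y ∷ ys) + changes (x ∷ y ∷ [])          ≡⟨ +-comm (changes (y ∷ ys)) _ ⟩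
  changes (x ∷ y ∷ []) + changes (y ∷ ys)          ≡⟨ changes-++ (x ∷ []) y ys ⟨
  changes (x ∷ y ∷ ys)                             ∎
  where open ≡-Reasoning

changes-∷ : ∀ x xs → WithinOne (changes xs) (changes (x ∷ xs))
changes-∷ x []       = inj₁ refl
changes-∷ x (y ∷ ys) with x ≟ y
... | yes _ = inj₁ refl
... | no  _ = inj₂ refl

changesFrom-∷ʳ : ∀ x xs z → WithinOne (changesFrom x xs) (changesFrom x (xs ∷ʳ z))
changesFrom-∷ʳ x [] z with x ≟ z
... | yes _ = inj₁ refl
... | no  _ = inj₂ refl
changesFrom-∷ʳ x (y ∷ ys) z with x ≟ y
... | yes _ = changesFrom-∷ʳ y ys z
... | no  _ = Sum.map (cong suc) (cong suc) (changesFrom-∷ʳ y ys z)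

changes-∷ʳ : ∀ xs z → WithinOne (changes xs) (changes (xs ∷ʳ z))
changes-∷ʳ []       z = inj₁ refl
changes-∷ʳ (x ∷ xs) z = changesFrom-∷ʳ x xs z

ℓ̄-repeat : ∀ x ys → ℓ̄ (x ∷ x ∷ ys) ≡ ℓ̄ (x ∷ ys)
ℓ̄-repeat x ys = cong (suc ∘ length)
  (trans (filter-reject x≢? (λ x≢x → x≢x refl)) (filter-idem x≢? (deduplicate _≟_ ys)))
  where x≢? = ¬? ∘ (x ≟_)

ℓ̄-fresh : ∀ x ys → All (x ≢_) ys → ℓ̄ (x ∷ ys) ≡ suc (ℓ̄ ys)
ℓ̄-fresh x ys fresh = cong (suc ∘ length) (filter-all (¬? ∘ (x ≟_)) (deduplicate⁺ _≟_ fresh))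

ℓ̄-sorted : ∀ {x xs} → Linked _≤_ (x ∷ xs) → ℓ̄ (x ∷ xs) ≡ suc (changes (x ∷ xs))
ℓ̄-sorted [-] = refl
ℓ̄-sorted {x} {y ∷ ys} (x≤y ∷ sorted) with x ≟ y
... | yes refl = trans (ℓ̄-repeat x ys) (ℓ̄-sorted sorted)
... | no x≢y   = trans (ℓ̄-fresh x (y ∷ ys) fresh) (cong suc (ℓ̄-sorted sorted))
  where fresh = All.map <⇒≢ (Linked⇒All ≤-trans (≤∧≢⇒< x≤y x≢y) sorted)

ℓ̄-sorted-∷ʳ : ∀ xs z → Linked _≤_ (xs ∷ʳ z) → ℓ̄ (xs ∷ʳ z) ≡ suc (changes (xs ∷ʳ z))
ℓ̄-sorted-∷ʳ []       z sorted = refl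
ℓ̄-sorted-∷ʳ (x ∷ xs) z sorted = ℓ̄-sorted sorted

module _ {A : Set} where

  Linked-++⁺ : ∀ {R : A → A → Set} xs {y ys} →
               Linked R (xs ∷ʳ y) → Linked R (y ∷ ys) → Linked R (xs ++ y ∷ ys)
  Linked-++⁺ []             _            rest = rest
  Linked-++⁺ (x ∷ [])       (r ∷ [-])    rest = r ∷ rest
  Linked-++⁺ (x ∷ x′ ∷ xs) (r ∷ prefix) rest = r ∷ Linked-++⁺ (x′ ∷ xs) prefix rest

  Linked-∷ʳ⁻ : ∀ {R : A → A → Set} xs {y} → Linked R (xs ∷ʳ y) → Linked R xs
  Linked-∷ʳ⁻ []             _           = []
  Linked-∷ʳ⁻ (x ∷ [])       _           = [-]
  Linked-∷ʳ⁻ (x ∷ x′ ∷ xs) (r ∷ linked) = r ∷ Linked-∷ʳ⁻ (x′ ∷ xs) linked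

  Linked-reverse⁺ : ∀ {R : A → A → Set} {xs} → Linked R xs → Linked (flip R) (reverse xs)
  Linked-reverse⁺ []                        = []
  Linked-reverse⁺ [-]                       = [-]
  Linked-reverse⁺ {R} {x ∷ y ∷ ys} (r ∷ linked) =
    subst (Linked (flip R)) (sym (reverse-++ (x ∷ y ∷ []) ys))
      (Linked-++⁺ (reverse ys) {y} {x ∷ []}
        (subst (Linked (flip R)) (unfold-reverse y ys) (Linked-reverse⁺ linked)) (r ∷ [-]))

  ∷⇒∷ʳ : ∀ (x : A) xs → ∃₂ λ ms w → x ∷ xs ≡ ms ∷ʳ w
  ∷⇒∷ʳ x []       = [] , x , refl
  ∷⇒∷ʳ x (y ∷ ys) with ∷⇒∷ʳ y ys
  ... | ms , w , eq = x ∷ ms , w , cong (x ∷_) eq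

Chain : (ℕ → ℕ) → List ℕ → Set
Chain f = Linked (λ a b → a ≢ b → f a ≡ b)

bump-repeat : ∀ f r x xs → bump f r (x ∷ x ∷ xs) ≡ x ∷ bump f r (x ∷ xs)
bump-repeat f zero    x xs = refl
bump-repeat f (suc r) x xs with x ≟ x
... | yes _   = refl
... | no x≢x = contradiction refl x≢x

bump-step : ∀ f r x y ys → x ≢ y → bump f (suc r) (x ∷ y ∷ ys) ≡ f x ∷ bump f r (y ∷ ys)
bump-step f r x y ys x≢y with x ≟ y
... | yes x≡y = contradiction x≡y x≢y
... | no _    = refl

bump-chain : ∀ f x xs z → Chain f (x ∷ (xs ∷ʳ z)) →
             bump f (changes (x ∷ (xs ∷ʳ z))) (x ∷ xs) ≡ xs ∷ʳ z
bump-chain f x [] z (fx≡z ∷ [-]) with x ≟ z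
... | yes refl = refl
... | no x≢z   = cong (_∷ []) (fx≡z x≢z)
bump-chain f x (y ∷ ys) z (fx≡y ∷ chain) with x ≟ y
... | yes refl =
  trans (bump-repeat f (changes (x ∷ (ys ∷ʳ z))) x ys) (cong (x ∷_) (bump-chain f x ys z chain))
... | no x≢y   =
  trans (bump-step f _ x y ys x≢y) (cong₂ _∷_ (fx≡y x≢y) (bump-chain f y ys z chain))

data Step : ℕ → ℕ → Set where
  stay : ∀ {a} → Step a a
  rise : ∀ {a} → Step a (suc a)

Staircase : List ℕ → Set
Staircase = Linked Step

step : ∀ {a b} → a ≤ b × b ≤ suc a → Step a b
step {a} {b} (a≤b , b≤1+a) with a ≟ b
... | yes refl = stay
... | no a≢b with ≤-antisym b≤1+a (≤∧≢⇒< a≤b a≢b)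
...   | refl = rise

Step⇒≤ : ∀ {a b} → Step a b → a ≤ b
Step⇒≤ stay = ≤-refl
Step⇒≤ rise = n≤1+n _

rise-chain : ∀ {a b} → Step a b → a ≢ b → suc a ≡ b
rise-chain stay a≢a = contradiction refl a≢a
rise-chain rise _   = refl

fall-chain : ∀ {a b} → Step a b → b ≢ a → pred b ≡ a
fall-chain stay a≢a = contradiction refl a≢a
fall-chain rise _   = refl

changes-stay : ∀ a → changes (a ∷ a ∷ []) ≡ 0
changes-stay a with a ≟ a
... | yes _   = refl
... | no a≢a = contradiction refl a≢a

changes-rise : ∀ a → changes (a ∷ suc a ∷ []) ≡ 1
changes-rise a with a ≟ suc a
... | yes a≡1+a = contradiction a≡1+a (<⇒≢ ≤-refl)
... | no _      = refl

record Rotation (r : ℕ) (P Q : List ℕ) : Set where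
  field
    ξ-source  : ξ r P ≡ Q
    ξ⁻-target : ξ⁻ r Q ≡ P
    ℓ̄-source  : WithinOne r (ℓ̄ P)
    ℓ̄-target  : WithinOne r (ℓ̄ Q)

suc-WithinOne : ∀ {n m c} → n ≡ suc m → WithinOne m c → WithinOne c n
suc-WithinOne refl (inj₁ refl) = inj₂ refl
suc-WithinOne refl (inj₂ refl) = inj₁ refl

rotation : ∀ a ms z → Staircase (a ∷ (ms ∷ʳ z)) →
           Rotation (changes (a ∷ (ms ∷ʳ z))) (a ∷ ms) (ms ∷ʳ z)
rotation a ms z st = record
  { ξ-source  = bump-chain suc a ms z (Linked.map rise-chain st)
  ; ξ⁻-target = backward
  ; ℓ̄-source  = suc-WithinOne (ℓ̄-sorted (Linked-∷ʳ⁻ (a ∷ ms) sorted)) (changes-∷ʳ (a ∷ ms) z)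
  ; ℓ̄-target  = suc-WithinOne (ℓ̄-sorted-∷ʳ ms z (Linked.tail sorted)) (changes-∷ a (ms ∷ʳ z))
  }
  where
    open ≡-Reasoning
    sorted = Linked.map Step⇒≤ st
    c = changes (a ∷ (ms ∷ʳ z))
    reversed : reverse (a ∷ (ms ∷ʳ z)) ≡ z ∷ (reverse ms ∷ʳ a)
    reversed = trans (reverse-++ (a ∷ ms) (z ∷ [])) (cong (z ∷_) (unfold-reverse a ms))
    c≡ : c ≡ changes (z ∷ (reverse ms ∷ʳ a))
    c≡ = trans (sym (changes-reverse (a ∷ (ms ∷ʳ z)))) (cong changes reversed)
    chain : Chain pred (z ∷ (reverse ms ∷ʳ a))
    chain = subst (Chain pred) reversed (Linked.map fall-chain (Linked-reverse⁺ st))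
    backward : ξ⁻ c (ms ∷ʳ z) ≡ a ∷ ms
    backward = begin
      reverse (bump pred c (reverse (ms ∷ʳ z)))
        ≡⟨ cong (λ l → reverse (bump pred c l)) (reverse-++ ms (z ∷ [])) ⟩
      reverse (bump pred c (z ∷ reverse ms))
        ≡⟨ cong (λ n → reverse (bump pred n (z ∷ reverse ms))) c≡ ⟩
      reverse (bump pred (changes (z ∷ (reverse ms ∷ʳ a))) (z ∷ reverse ms))
        ≡⟨ cong reverse (bump-chain pred z (reverse ms) a chain) ⟩
      reverse (reverse ms ∷ʳ a)
        ≡⟨ reverse-++ (reverse ms) (a ∷ []) ⟩
      a ∷ reverse (reverse ms)
        ≡⟨ cong (a ∷_) (reverse-involutive ms) ⟩
      a ∷ ms ∎

append-rotation : ∀ {x xs ms w z} → x ∷ xs ≡ ms ∷ʳ w → Staircase (x ∷ xs) → Step w z →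
                  Rotation (changes (x ∷ xs) + changes (w ∷ z ∷ [])) (x ∷ xs) (xs ∷ʳ z)
append-rotation {x} {xs} {ms} {w} {z} L≡ st w~z =
  subst (λ c → Rotation c (x ∷ xs) (xs ∷ʳ z)) count (rotation x xs z extended)
  where
    split : (x ∷ xs) ∷ʳ z ≡ ms ++ w ∷ z ∷ []
    split = trans (cong (_∷ʳ z) L≡) (++-assoc ms (w ∷ []) (z ∷ []))
    extended : Staircase (x ∷ (xs ∷ʳ z))
    extended = subst Staircase (sym split) (Linked-++⁺ ms (subst Staircase L≡ st) (w~z ∷ [-]))
    count : changes (x ∷ (xs ∷ʳ z)) ≡ changes (x ∷ xs) + changes (w ∷ z ∷ [])
    count = trans (cong changes split)
      (trans (changes-++ ms w (z ∷ [])) (cong (λ l → changes l + changes (w ∷ z ∷ [])) (sym L≡)))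

prepend-rotation : ∀ {x xs ms w y} → x ∷ xs ≡ ms ∷ʳ w → Staircase (x ∷ xs) → Step y x →
                   Rotation (changes (y ∷ x ∷ []) + changes (x ∷ xs)) (y ∷ ms) (x ∷ xs)
prepend-rotation {x} {xs} {ms} {w} {y} L≡ st y~x =
  subst₂ (λ c Q → Rotation c (y ∷ ms) Q) count (sym L≡)
    (rotation y ms w (subst (Staircase ∘ (y ∷_)) L≡ (y~x ∷ st)))
  where
    count : changes (y ∷ (ms ∷ʳ w)) ≡ changes (y ∷ x ∷ []) + changes (x ∷ xs)
    count = trans (cong (changes ∘ (y ∷_)) (sym L≡)) (changes-++ (y ∷ []) x xs)

boundary-steps : ∀ {r c} → WithinOne c r → ∀ w x →
                 ∃₂ λ z y → Step w z × Step y (suc x)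
                          × r ≡ c + changes (w ∷ z ∷ []) × r ≡ changes (y ∷ suc x ∷ []) + c
boundary-steps {c = c} (inj₁ refl) w x =
  w , suc x , stay , stay ,
  sym (trans (cong (c +_) (changes-stay w)) (+-identityʳ c)) ,
  sym (cong (_+ c) (changes-stay (suc x)))
boundary-steps {c = c} (inj₂ refl) w x =
  suc w , x , rise , rise ,
  sym (trans (cong (c +_) (changes-rise w)) (+-comm c 1)) , sym (cong (_+ c) (changes-rise x))

mutually-inverse : ∀ {r P L Q} → Rotation r L Q → Rotation r P L →
                   WithinOne r (ℓ̄ (ξ r L)) × WithinOne r (ℓ̄ (ξ⁻ r L))
                   × (ξ⁻ r (ξ r L) ≡ L × ξ r (ξ⁻ r L) ≡ L)
mutually-inverse {r} after before =
    subst (WithinOne r ∘ ℓ̄) (sym (ξ-source after)) (ℓ̄-target after)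
  , subst (WithinOne r ∘ ℓ̄) (sym (ξ⁻-target before)) (ℓ̄-source before)
  , trans (cong (ξ⁻ r) (ξ-source after)) (ξ⁻-target after)
  , trans (cong (ξ r) (ξ⁻-target before)) (ξ-source before)
  where open Rotation

lemma5p2 : (λs : List ℕ) → IsPartition λs → GapFree λs → SmallestPartGt1 λs →
    (r : ℕ) → (suc r ≡ ℓ̄ λs ⊎ r ≡ ℓ̄ λs) →
    ((ℓ̄ (ξ r λs) ≡ r ⊎ ℓ̄ (ξ r λs) ≡ suc r)
    × (ℓ̄ (ξ⁻ r λs) ≡ r ⊎ ℓ̄ (ξ⁻ r λs) ≡ suc r)
    × (ξ⁻ r (ξ r λs) ≡ λs × ξ r (ξ⁻ r λs) ≡ λs))
lemma5p2 []            _           _       ()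
lemma5p2 (zero ∷ xs)   _           _       ()
lemma5p2 (suc x ∷ xs) (sorted , _) gapFree _ r r≈ℓ̄ =
  let ms , w , L≡                   = ∷⇒∷ʳ (suc x) xs
      z , y , w~z , y~x , r≡₁ , r≡₂ = boundary-steps rank w x
  in mutually-inverse
       (subst (λ c → Rotation c (suc x ∷ xs) (xs ∷ʳ z)) (sym r≡₁) (append-rotation L≡ st w~z))
       (subst (λ c → Rotation c (y ∷ ms) (suc x ∷ xs)) (sym r≡₂) (prepend-rotation L≡ st y~x))
  where
    st : Staircase (suc x ∷ xs)
    st = Linked.zipWith step (sorted , gapFree)
    ℓ̄≡ : ℓ̄ (suc x ∷ xs) ≡ suc (changes (suc x ∷ xs))
    ℓ̄≡ = ℓ̄-sorted sorted
    rank : WithinOne (changes (suc x ∷ xs)) r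
    rank = Sum.map (λ e → suc-injective (trans e ℓ̄≡)) (λ e → trans e ℓ̄≡) r≈ℓ̄
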